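{- Let $r \ge 2$ and $\delta \in (0,1]$. Let $\mathcal H$ be a $\delta$-intersecting $r$-partite multi-$r$-graph. Then there exists an $r$-edge-coloured graph $G$ with $\delta(G) \ge (1-\delta)|V(G)| - 1$ and $tc(G) = \tau(\mathcal H)$.
   Context: A multi-$r$-graph is a hypergraph whose edges are $r$-element vertex sets, with repeated edges allowed; it is $r$-partite if its vertex set can be partitioned into $r$ parts such that every edge contains exactly one vertex from each part. $e(\mathcal H)$ is its number of edges counted with multiplicity. A multi-hypergraph $\mathcal H$ is $\delta$-intersecting if every edge $e$ intersects at least $(1-\delta)e(\mathcal H)$ edges of $\mathcal H$ (counted with multiplicity; $e$ intersects itself). A transversal is a vertex set meeting every edge; $\tau(\mathcal H)$ is the minimum size of a transversal. An $r$-edge-coloured graph is a simple graph $G$ with a colouring $\chi:E(G)\to[r]$; $\delta(G)$ is its minimum (uncoloured) degree. A monochromatic tree is a tree subgraph with all edges of one colour (single vertices allowed), and $tc(G)$ is the minimum number of monochromatic trees (not necessarily disjoint) whose vertex sets cover $V(G)$.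
   Formalization: The parameter δ takes only rational values in (0,1]. -}

module Defs where

open import Data.Nat as ℕ using (ℕ; zero; suc; _≤_)
open import Data.Integer using (+_)
open import Data.Rational as ℚ using (ℚ; _/_; _*_; _-_; 1ℚ)
open import Data.Fin using (Fin)
open import Data.List using (allFin)
open import Data.Empty using (⊥)
open import Data.Fin.Properties using (any?; _≟_)
open import Data.Fin.Subset using (Subset; _∈_; ∣_∣)
open import Data.List using (List; []; _∷_; _++_; length; filter)
open import Data.List.Relation.Unary.All using (All)
open import Data.List.Relation.Unary.Unique.Propositional using (Unique)
open import Data.List.Relation.Unary.Linked using (Linked)
open import Data.Maybe using (Maybe; just; nothing; is-just)
open import Data.Bool using (Bool; true; T)
open import Data.Product using (Σ; Σ-syntax; ∃; ∃-syntax; _×_)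
open import Relation.Binary.PropositionalEquality using (_≡_; _≢_)
open import Relation.Binary.Definitions using (Decidable)
open import Relation.Nullary.Decidable using (T?)

ℕtoℚ : ℕ → ℚ
ℕtoℚ n = (+ n) / 1

-- Vertices are Fin N; `part` is the partition into r parts; an edge is
-- given by its r vertices (e i is the vertex of the edge in part i), so
-- every edge contains exactly one vertex from each part.  Edges form a
-- list, so repeated edges are allowed (multiplicity).

record RPartiteMultiGraph (r : ℕ) : Set where
  field
    N       : ℕ
    part    : Fin N → Fin r
    edges   : List (Fin r → Fin N)
    partite : All (λ e → ∀ i → part (e i) ≡ i) edges

module _ {r N : ℕ} where
  Intersects : (Fin r → Fin N) → (Fin r → Fin N) → Set
  Intersects e f = ∃[ i ] ∃[ j ] e i ≡ f j

  intersects? : Decidable Intersects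
  intersects? e f = any? (λ i → any? (λ j → e i ≟ f j))

eH : ∀ {r} → RPartiteMultiGraph r → ℕ
eH H = length (RPartiteMultiGraph.edges H)

intersectCount : ∀ {r} (H : RPartiteMultiGraph r) →
                 (Fin r → Fin (RPartiteMultiGraph.N H)) → ℕ
intersectCount H e = length (filter (intersects? e) (RPartiteMultiGraph.edges H))

DeltaIntersecting : ∀ {r} → ℚ → RPartiteMultiGraph r → Set
DeltaIntersecting δ H =
  All (λ e → ℚ._≤_ ((1ℚ - δ) * ℕtoℚ (eH H)) (ℕtoℚ (intersectCount H e)))
      (RPartiteMultiGraph.edges H)

IsTransversal : ∀ {r} (H : RPartiteMultiGraph r) → Subset (RPartiteMultiGraph.N H) → Set
IsTransversal H T = All (λ e → ∃[ i ] e i ∈ T) (RPartiteMultiGraph.edges H)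

IsTau : ∀ {r} → RPartiteMultiGraph r → ℕ → Set
IsTau H t = (Σ[ T ∈ Subset (RPartiteMultiGraph.N H) ] IsTransversal H T × ∣ T ∣ ≡ t)
          × (∀ T → IsTransversal H T → t ≤ ∣ T ∣)

-- r-edge-coloured (simple) graphs on vertex set Fin m.
-- col u v ≡ nothing : u, v non-adjacent;  col u v ≡ just c : uv is an
-- edge of colour c.

record ColouredGraph (r : ℕ) : Set where
  field
    m      : ℕ
    col    : Fin m → Fin m → Maybe (Fin r)
    sym    : ∀ u v → col u v ≡ col v u
    irrefl : ∀ v → col v v ≡ nothing

module _ {r : ℕ} (G : ColouredGraph r) where
  open ColouredGraph G

  degree : Fin m → ℕ
  degree v = length (filter (λ w → T? (is-just (col v w))) (allFin m))

  MinDegreeAtLeast : ℚ → Set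
  MinDegreeAtLeast x = ∀ v → ℚ._≤_ x (ℕtoℚ (degree v))

module _ {m : ℕ} (F : Fin m → Fin m → Bool) where
  Adj : Fin m → Fin m → Set
  Adj u v = F u v ≡ true

  data Walk : Fin m → Fin m → Set where
    stop : ∀ {u} → Walk u u
    step : ∀ {u w v} → Adj u w → Walk w v → Walk u v

  -- a cycle v, v₁, …, v_k, v with k ≥ 2 and all of v, v₁, …, v_k distinct
  HasCycle : Set
  HasCycle = Σ[ v ∈ Fin m ] Σ[ vs ∈ List (Fin m) ]
               2 ≤ length vs × Unique (v ∷ vs) × Linked Adj (v ∷ vs ++ v ∷ [])

record MonoTree {r : ℕ} (G : ColouredGraph r) : Set where
  open ColouredGraph G
  field
    colour  : Fin r
    S       : Subset m
    F       : Fin m → Fin m → Bool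
    F-sym   : ∀ u v → F u v ≡ F v u
    F-edge  : ∀ u v → F u v ≡ true → col u v ≡ just colour
    F-inS   : ∀ u v → F u v ≡ true → u ∈ S × v ∈ S
    nonempty  : ∃[ v ] v ∈ S
    connected : ∀ u v → u ∈ S → v ∈ S → Walk F u v
    acyclic   : HasCycle F → ⊥

CoveringTrees : ∀ {r} (G : ColouredGraph r) → ℕ → Set
CoveringTrees G k =
  Σ[ Ts ∈ (Fin k → MonoTree G) ] (∀ v → ∃[ i ] v ∈ MonoTree.S (Ts i))

IsTC : ∀ {r} → ColouredGraph r → ℕ → Set
IsTC G t = CoveringTrees G t × (∀ k → CoveringTrees G k → t ≤ k)

-- Vertices of G are the edges of H. Fix a minimum transversal T and anchor every edge of H
-- at one of its vertices in T. Two edges sharing their part-i vertex are joined in colour i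
-- (in the colour of the anchor's part if they share the anchor), so each edge is adjacent to
-- every other edge it meets, which is the degree bound. The edges anchored at one vertex of T
-- form a monochromatic star, hence |T| trees cover G. Conversely, along a monochromatic tree
-- of colour i all edges share their part-i vertex, so k covering trees give a transversal of
-- size at most k.
module Submission where

open import Defs
open import Data.Nat using (ℕ; _≤_)
open import Data.Rational using (ℚ; 0ℚ; 1ℚ; _<_; _-_; _*_) renaming (_≤_ to _≤ℚ_)
open import Data.Product using (Σ-syntax; _×_)

open import Data.Bool as Bool using (Bool; true; false)
open import Data.Empty using () renaming (⊥ to Empty; ⊥-elim to Empty-elim)
open import Data.Fin using (Fin; zero; suc)
import Data.Fin.Properties as Finₚ
open import Data.Fin.Subset using (Subset; _∈_; ∣_∣; ⊥; ⊤; ⁅_⁆; _∪_; inside; outside)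
open import Data.Fin.Subset.Properties
  using (x∈⁅x⁆; p⊆p∪q; q⊆p∪q; ∣⁅x⁆∣≡1; ∣⊥∣≡0; anySubset?; _∈?_; ∈⊤)
open import Data.Integer as ℤ using (+_; -[1+_])
import Data.Integer.Properties as ℤₚ
open import Data.List using ([]; _∷_; length; filter; tabulate; lookup)
open import Data.List.Properties using (tabulate-lookup)
open import Data.List.Membership.Propositional.Properties using (∈-lookup)
open import Data.List.Relation.Unary.All as All using (_∷_)
open import Data.List.Relation.Unary.AllPairs using (_∷_)
open import Data.List.Relation.Unary.Any using (index)
open import Data.List.Relation.Unary.Any.Properties using (lookup-index)
open import Data.List.Relation.Unary.Linked using ([-]; _∷_)
open import Data.Maybe using (Maybe; just; nothing; is-just)
open import Data.Nat as ℕ using (zero; suc; s≤s; z≤n)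
open import Data.Nat.Coprimality as Coprime using ()
open import Data.Nat.Induction using (<-wellFounded)
import Data.Nat.Properties as ℕₚ
open import Data.Product using (∃-syntax; _,_; proj₁; proj₂)
open import Data.Rational using (mkℚ; -_; toℚᵘ)
import Data.Rational.Properties as ℚₚ
import Data.Rational.Unnormalised as ℚᵘ
import Data.Rational.Unnormalised.Properties as ℚᵘₚ
open import Data.Sum using (_⊎_; inj₁; inj₂)
open import Data.Vec as Vec using (here; there)
open import Data.Vec using ([]; _∷_)
import Data.Vec.Properties as Vecₚ
open import Function using (_∘_; id)
open import Function.Bundles using (mk⇔)
open import Induction.WellFounded using (Acc; acc)
open import Level using (0ℓ)
open import Relation.Binary using (tri<; tri≈; tri>)
open import Relation.Binary.PropositionalEquality
open import Relation.Nullary using (Dec; yes; no; does; ¬?; contradiction)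
open import Relation.Nullary.Decidable using (dec-true; does-⇔; _×-dec_; _⊎-dec_; T?)
open import Relation.Unary using (Pred; Decidable)

ℕtoℚ≡mkℚ : ∀ n → ℕtoℚ n ≡ mkℚ (+ n) 0 (Coprime.sym (Coprime.1-coprimeTo n))
ℕtoℚ≡mkℚ n = ℚₚ.normalize-coprime (Coprime.sym (Coprime.1-coprimeTo n))

-- The gcd in ℕtoℚ blocks computation, so the inequality is checked on unnormalised rationals.
ℕtoℚ-pred-≤ : ∀ {q d} → q ℕ.≤ suc d → ℕtoℚ q - 1ℚ ≤ℚ ℕtoℚ d
ℕtoℚ-pred-≤ {q} {d} q≤1+d = ℚₚ.toℚᵘ-cancel-≤
  (ℚᵘₚ.≤-respˡ-≃ (ℚᵘₚ.≃-sym (ℚₚ.toℚᵘ-homo-+ (ℕtoℚ q) (- 1ℚ))) unnormalised)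
  where
  unnormalised : toℚᵘ (ℕtoℚ q) ℚᵘ.+ toℚᵘ (- 1ℚ) ℚᵘ.≤ toℚᵘ (ℕtoℚ d)
  unnormalised rewrite ℕtoℚ≡mkℚ q | ℕtoℚ≡mkℚ d =
    ℚᵘ.*≤* (subst₂ ℤ._≤_ (sym cleared) (sym (ℤₚ.*-identityʳ (+ d))) q-1≤d)
    where
    cleared : (+ q ℤ.* + 1 ℤ.+ -[1+ 0 ] ℤ.* + 1) ℤ.* + 1 ≡ + q ℤ.+ -[1+ 0 ]
    cleared = trans (ℤₚ.*-identityʳ _) (cong (ℤ._+ -[1+ 0 ]) (ℤₚ.*-identityʳ (+ q)))
    q-1≤d : + q ℤ.+ -[1+ 0 ] ℤ.≤ + d
    q-1≤d = ℤₚ.+-monoˡ-≤ -[1+ 0 ] (ℤ.+≤+ q≤1+d)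

∣p∪q∣≤∣p∣+∣q∣ : ∀ {n} (p q : Subset n) → ∣ p ∪ q ∣ ℕ.≤ ∣ p ∣ ℕ.+ ∣ q ∣
∣p∪q∣≤∣p∣+∣q∣ []           []           = z≤n
∣p∪q∣≤∣p∣+∣q∣ (inside ∷ p)  (inside ∷ q)  = s≤s (ℕₚ.≤-trans (∣p∪q∣≤∣p∣+∣q∣ p q) (ℕₚ.+-monoʳ-≤ ∣ p ∣ (ℕₚ.n≤1+n ∣ q ∣)))
∣p∪q∣≤∣p∣+∣q∣ (inside ∷ p)  (outside ∷ q) = s≤s (∣p∪q∣≤∣p∣+∣q∣ p q)
∣p∪q∣≤∣p∣+∣q∣ (outside ∷ p) (inside ∷ q)  = subst (∣ p ∪ q ∣ ℕ.<_) (sym (ℕₚ.+-suc ∣ p ∣ ∣ q ∣)) (s≤s (∣p∪q∣≤∣p∣+∣q∣ p q))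
∣p∪q∣≤∣p∣+∣q∣ (outside ∷ p) (outside ∷ q) = ∣p∪q∣≤∣p∣+∣q∣ p q

image : ∀ {k n} → (Fin k → Fin n) → Subset n
image {zero}  h = ⊥
image {suc k} h = ⁅ h zero ⁆ ∪ image (h ∘ suc)

∈-image : ∀ {k n} (h : Fin k → Fin n) i → h i ∈ image h
∈-image h zero    = p⊆p∪q (image (h ∘ suc)) (x∈⁅x⁆ (h zero))
∈-image h (suc i) = q⊆p∪q ⁅ h zero ⁆ (image (h ∘ suc)) (∈-image (h ∘ suc) i)

∣image∣≤ : ∀ {k n} (h : Fin k → Fin n) → ∣ image h ∣ ℕ.≤ k
∣image∣≤ {zero}  {n} h = ℕₚ.≤-reflexive (∣⊥∣≡0 n)
∣image∣≤ {suc k}     h = ℕₚ.≤-trans (∣p∪q∣≤∣p∣+∣q∣ ⁅ h zero ⁆ (image (h ∘ suc)))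
  (subst (λ s → s ℕ.+ ∣ image (h ∘ suc) ∣ ℕ.≤ suc k) (sym (∣⁅x⁆∣≡1 (h zero))) (s≤s (∣image∣≤ (h ∘ suc))))

enumerate : ∀ {n} (p : Subset n) → Fin ∣ p ∣ → Fin n
enumerate (inside ∷ p)  zero    = zero
enumerate (inside ∷ p)  (suc j) = suc (enumerate p j)
enumerate (outside ∷ p) j       = suc (enumerate p j)

enumerate-surjective : ∀ {n} (p : Subset n) {x} → x ∈ p → ∃[ j ] enumerate p j ≡ x
enumerate-surjective (inside ∷ p)  here       = zero , refl
enumerate-surjective (inside ∷ p)  (there x∈p) with j , eq ← enumerate-surjective p x∈p = suc j , cong suc eq
enumerate-surjective (outside ∷ p) (there x∈p) with j , eq ← enumerate-surjective p x∈p = j , cong suc eq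

from-does : ∀ {A : Set} (A? : Dec A) → does A? ≡ true → A
from-does (yes a) _ = a

fromDecidable : ∀ {n} {P : Pred (Fin n) 0ℓ} → Decidable P → Subset n
fromDecidable P? = Vec.tabulate (does ∘ P?)

∈-fromDecidable⁺ : ∀ {n} {P : Pred (Fin n) 0ℓ} (P? : Decidable P) {x} → P x → x ∈ fromDecidable P?
∈-fromDecidable⁺ P? {x} Px = Vecₚ.lookup⇒[]= x _ (trans (Vecₚ.lookup∘tabulate _ x) (dec-true (P? x) Px))

∈-fromDecidable⁻ : ∀ {n} {P : Pred (Fin n) 0ℓ} (P? : Decidable P) {x} → x ∈ fromDecidable P? → P x
∈-fromDecidable⁻ P? {x} x∈ = from-does (P? x) (trans (sym (Vecₚ.lookup∘tabulate _ x)) (Vecₚ.[]=⇒lookup x∈))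

minimum-size : ∀ {n} {P : Pred (Subset n) 0ℓ} → Decidable P → ∀ {p} → P p →
               Σ[ q ∈ Subset n ] P q × (∀ q′ → P q′ → ∣ q ∣ ℕ.≤ ∣ q′ ∣)
minimum-size {P = P} P? {p} Pp = descend p Pp (<-wellFounded ∣ p ∣)
  where
  descend : ∀ p → P p → Acc ℕ._<_ ∣ p ∣ → Σ[ q ∈ Subset _ ] P q × (∀ q′ → P q′ → ∣ q ∣ ℕ.≤ ∣ q′ ∣)
  descend p Pp (acc smaller) with anySubset? (λ q → P? q ×-dec (∣ q ∣ ℕₚ.<? ∣ p ∣))
  ... | yes (q , Pq , q<p) = descend q Pq (smaller q<p)
  ... | no ∄smaller = p , Pp , λ q Pq → ℕₚ.≮⇒≥ (λ q<p → ∄smaller (q , Pq , q<p))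

module _ {A : Set} {P : Pred A 0ℓ} (P? : Decidable P) where

  count-≤-count-∷ : ∀ {x xs} → length (filter P? xs) ℕ.≤ length (filter P? (x ∷ xs))
  count-≤-count-∷ {x} with does (P? x)
  ... | true  = ℕₚ.n≤1+n _
  ... | false = ℕₚ.≤-refl

  count-∷-≤-suc : ∀ {x xs} → length (filter P? (x ∷ xs)) ℕ.≤ suc (length (filter P? xs))
  count-∷-≤-suc {x} with does (P? x)
  ... | true  = ℕₚ.≤-refl
  ... | false = ℕₚ.n≤1+n _

module _ {A B : Set} {P : Pred A 0ℓ} {Q : Pred B 0ℓ} (P? : Decidable P) (Q? : Decidable Q) where

  count-∷-mono : ∀ k {x y xs ys} → (P x → Q y) →
                 length (filter P? xs) ℕ.≤ k ℕ.+ length (filter Q? ys) →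
                 length (filter P? (x ∷ xs)) ℕ.≤ k ℕ.+ length (filter Q? (y ∷ ys))
  count-∷-mono k {x} {y} {xs} P⇒Q xs≤ys with P? x | Q? y
  ... | yes Px | no ¬Qy = Empty-elim (¬Qy (P⇒Q Px))
  ... | yes _  | yes _  = subst (suc (length (filter P? xs)) ℕ.≤_) (sym (ℕₚ.+-suc k _)) (s≤s xs≤ys)
  ... | no _   | yes _  = ℕₚ.≤-trans xs≤ys (ℕₚ.+-monoʳ-≤ k (ℕₚ.n≤1+n _))
  ... | no _   | no _   = xs≤ys

  count-tabulate-mono : ∀ {n} (f : Fin n → A) (g : Fin n → B) → (∀ i → P (f i) → Q (g i)) →
                        length (filter P? (tabulate f)) ℕ.≤ length (filter Q? (tabulate g))
  count-tabulate-mono {zero}  f g P⇒Q = z≤n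
  count-tabulate-mono {suc n} f g P⇒Q =
    count-∷-mono 0 (P⇒Q zero) (count-tabulate-mono (f ∘ suc) (g ∘ suc) (P⇒Q ∘ suc))

  count-tabulate-mono-except : ∀ {n} (f : Fin n → A) (g : Fin n → B) (u : Fin n) →
                               (∀ i → i ≢ u → P (f i) → Q (g i)) →
                               length (filter P? (tabulate f)) ℕ.≤ suc (length (filter Q? (tabulate g)))
  count-tabulate-mono-except f g zero P⇒Q = ℕₚ.≤-trans (count-∷-≤-suc P?) (s≤s (ℕₚ.≤-trans
    (count-tabulate-mono (f ∘ suc) (g ∘ suc) (λ i → P⇒Q (suc i) λ ())) (count-≤-count-∷ Q?)))
  count-tabulate-mono-except f g (suc u) P⇒Q =
    count-∷-mono 1 (P⇒Q zero λ ())
      (count-tabulate-mono-except (f ∘ suc) (g ∘ suc) u (λ i i≢u → P⇒Q (suc i) (i≢u ∘ Finₚ.suc-injective)))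

module _ {A : Set} {m : ℕ} (diagonal : A) (f : Fin m → Fin m → A) where

  symmetrise : Fin m → Fin m → A
  symmetrise u v with Finₚ.<-cmp u v
  ... | tri< _ _ _ = f u v
  ... | tri≈ _ _ _ = diagonal
  ... | tri> _ _ _ = f v u

  symmetrise-sym : ∀ u v → symmetrise u v ≡ symmetrise v u
  symmetrise-sym u v with Finₚ.<-cmp u v | Finₚ.<-cmp v u
  ... | tri< _ _ _   | tri> _ _ _   = refl
  ... | tri> _ _ _   | tri< _ _ _   = refl
  ... | tri≈ _ _ _   | tri≈ _ _ _   = refl
  ... | tri< u<v _ _ | tri< v<u _ _ = Empty-elim (Finₚ.<-asym u<v v<u)
  ... | tri< _ u≢v _ | tri≈ _ v≡u _ = Empty-elim (u≢v (sym v≡u))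
  ... | tri≈ _ u≡v _ | tri< _ v≢u _ = Empty-elim (v≢u (sym u≡v))
  ... | tri≈ _ u≡v _ | tri> _ v≢u _ = Empty-elim (v≢u (sym u≡v))
  ... | tri> _ u≢v _ | tri≈ _ v≡u _ = Empty-elim (u≢v (sym v≡u))
  ... | tri> _ _ v<u | tri> _ _ u<v = Empty-elim (Finₚ.<-asym u<v v<u)

  symmetrise-diagonal : ∀ v → symmetrise v v ≡ diagonal
  symmetrise-diagonal v with Finₚ.<-cmp v v
  ... | tri< _ v≢v _ = Empty-elim (v≢v refl)
  ... | tri≈ _ _ _   = refl
  ... | tri> _ v≢v _ = Empty-elim (v≢v refl)

  symmetrise-off-diagonal : ∀ {u v} → u ≢ v → symmetrise u v ≡ f u v ⊎ symmetrise u v ≡ f v u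
  symmetrise-off-diagonal {u} {v} u≢v with Finₚ.<-cmp u v
  ... | tri< _ _ _   = inj₁ refl
  ... | tri≈ _ u≡v _ = Empty-elim (u≢v u≡v)
  ... | tri> _ _ _   = inj₂ refl

_++ʷ_ : ∀ {m} {F : Fin m → Fin m → Bool} {u v w} → Walk F u v → Walk F v w → Walk F u w
stop          ++ʷ q = q
step adj rest ++ʷ q = step adj (rest ++ʷ q)

module Star {r} (G : ColouredGraph r) (k : Fin r) (S : Subset (ColouredGraph.m G))
            (c : Fin (ColouredGraph.m G)) (c∈S : c ∈ S)
            (spoke-colour : ∀ u → u ∈ S → u ≢ c → ColouredGraph.col G u c ≡ just k) where
  open ColouredGraph G using (m; col)

  Spoke : Fin m → Fin m → Set
  Spoke u v = u ≡ c × v ∈ S × v ≢ c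

  StarEdge : Fin m → Fin m → Set
  StarEdge u v = Spoke u v ⊎ Spoke v u

  star-edge? : ∀ u v → Dec (StarEdge u v)
  star-edge? u v = spoke? u v ⊎-dec spoke? v u
    where
    spoke? : ∀ u v → Dec (Spoke u v)
    spoke? u v = (u Finₚ.≟ c) ×-dec (v ∈? S) ×-dec ¬? (v Finₚ.≟ c)

  F : Fin m → Fin m → Bool
  F u v = does (star-edge? u v)

  swap-edge : ∀ {u v} → StarEdge u v → StarEdge v u
  swap-edge (inj₁ s) = inj₂ s
  swap-edge (inj₂ s) = inj₁ s

  edge : ∀ {u v} → Adj F u v → StarEdge u v
  edge {u} {v} = from-does (star-edge? u v)

  centre-on-edge : ∀ {u v} → Adj F u v → u ≡ c ⊎ v ≡ c
  centre-on-edge a with edge a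
  ... | inj₁ (u≡c , _) = inj₁ u≡c
  ... | inj₂ (v≡c , _) = inj₂ v≡c

  edge-colour : ∀ u v → Adj F u v → col u v ≡ just k
  edge-colour u v a with edge {u} {v} a
  ... | inj₁ (refl , v∈S , v≢c) = trans (ColouredGraph.sym G c v) (spoke-colour v v∈S v≢c)
  ... | inj₂ (refl , u∈S , u≢c) = spoke-colour u u∈S u≢c

  edge-inside : ∀ u v → Adj F u v → u ∈ S × v ∈ S
  edge-inside u v a with edge {u} {v} a
  ... | inj₁ (refl , v∈S , _) = c∈S , v∈S
  ... | inj₂ (refl , u∈S , _) = u∈S , c∈S

  walk-to-centre : ∀ u → u ∈ S → Walk F u c
  walk-to-centre u u∈S with u Finₚ.≟ c
  ... | yes refl = stop
  ... | no u≢c   = step (dec-true (star-edge? u c) (inj₂ (refl , u∈S , u≢c))) stop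

  walk-from-centre : ∀ v → v ∈ S → Walk F c v
  walk-from-centre v v∈S with v Finₚ.≟ c
  ... | yes refl = stop
  ... | no v≢c   = step (dec-true (star-edge? c v) (inj₁ (refl , v∈S , v≢c))) stop

  middle-is-centre : ∀ {a b x} → Adj F a b → Adj F b x → a ≢ x → b ≡ c
  middle-is-centre ab bx a≢x with centre-on-edge ab | centre-on-edge bx
  ... | inj₂ b≡c | _        = b≡c
  ... | inj₁ _   | inj₁ b≡c = b≡c
  ... | inj₁ a≡c | inj₂ x≡c = Empty-elim (a≢x (trans a≡c (sym x≡c)))

  -- Both v₁ and v₂ turn out to be the centre: the vertex after v₂ (v itself, or v₃) differs from v₁.
  acyclic : HasCycle F → Empty
  acyclic (_ , _ ∷ [] , s≤s () , _)
  acyclic (v , v₁ ∷ v₂ ∷ [] , _ , (v≢v₁ ∷ v≢v₂ ∷ _) ∷ (v₁≢v₂ ∷ _) ∷ _ , a₀ ∷ a₁ ∷ a₂ ∷ [-]) =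
    v₁≢v₂ (trans (middle-is-centre a₀ a₁ v≢v₂) (sym (middle-is-centre a₁ a₂ (v≢v₁ ∘ sym))))
  acyclic (v , v₁ ∷ v₂ ∷ _ ∷ _ , _ , (_ ∷ v≢v₂ ∷ _) ∷ (v₁≢v₂ ∷ v₁≢v₃ ∷ _) ∷ _ , a₀ ∷ a₁ ∷ a₂ ∷ _) =
    v₁≢v₂ (trans (middle-is-centre a₀ a₁ v≢v₂) (sym (middle-is-centre a₁ a₂ v₁≢v₃)))

  tree : MonoTree G
  tree = record
    { colour    = k
    ; S         = S
    ; F         = F
    ; F-sym     = λ u v → does-⇔ (mk⇔ swap-edge swap-edge) (star-edge? u v) (star-edge? v u)
    ; F-edge    = edge-colour
    ; F-inS     = edge-inside
    ; nonempty  = c , c∈S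
    ; connected = λ u v u∈S v∈S → walk-to-centre u u∈S ++ʷ walk-from-centre v v∈S
    ; acyclic   = acyclic
    }

module _ {r} (H : RPartiteMultiGraph r) where
  open RPartiteMultiGraph H

  transversal? : Decidable (IsTransversal H)
  transversal? T = All.all? (λ e → Finₚ.any? (λ i → e i ∈? T)) edges

  ⊤-transversal : Fin r → IsTransversal H ⊤
  ⊤-transversal i = All.tabulate (λ _ → i , ∈⊤)

  transversal-by-index : ∀ {T} → (∀ w → ∃[ i ] lookup edges w i ∈ T) → IsTransversal H T
  transversal-by-index {T} hits =
    All.tabulate (λ e∈ → subst (λ e → ∃[ i ] e i ∈ T) (sym (lookup-index e∈)) (hits (index e∈)))

module TransversalGraph {r} (H : RPartiteMultiGraph r) (T : Subset (RPartiteMultiGraph.N H))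
                        (T-transversal : IsTransversal H T) where
  open RPartiteMultiGraph H

  m : ℕ
  m = eH H

  edge : Fin m → Fin r → Fin N
  edge = lookup edges

  edge-part : ∀ w i → part (edge w i) ≡ i
  edge-part w = All.lookup partite (∈-lookup w)

  same-part : ∀ {u v i j} → edge u i ≡ edge v j → i ≡ j
  same-part {u} {v} {i} {j} eq = trans (sym (edge-part u i)) (trans (cong part eq) (edge-part v j))

  hit : Fin m → Fin r
  hit w = proj₁ (All.lookup T-transversal (∈-lookup w))

  anchor : Fin m → Fin N
  anchor w = edge w (hit w)

  anchor∈T : ∀ w → anchor w ∈ T
  anchor∈T w = proj₂ (All.lookup T-transversal (∈-lookup w))

  -- A common anchor takes priority over other shared vertices, so that each anchor class
  -- spans a monochromatic star.
  link : Fin m → Fin m → Maybe (Fin r)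
  link u v with anchor u Finₚ.≟ anchor v | intersects? (edge u) (edge v)
  ... | yes _ | _               = just (hit u)
  ... | no _  | yes (i , _ , _) = just i
  ... | no _  | no _            = nothing

  link-shares : ∀ {u v c} → link u v ≡ just c → edge u c ≡ edge v c
  link-shares {u} {v} eq with anchor u Finₚ.≟ anchor v | intersects? (edge u) (edge v)
  link-shares {u} {v} refl | yes u~v | _               = trans u~v (cong (edge v) (sym (same-part u~v)))
  link-shares {u} {v} refl | no _    | yes (_ , _ , e) = trans e (cong (edge v) (sym (same-part e)))

  link-anchor : ∀ {u v} → anchor u ≡ anchor v → link u v ≡ just (hit u)
  link-anchor {u} {v} u~v with anchor u Finₚ.≟ anchor v
  ... | yes _   = refl
  ... | no u≁v = Empty-elim (u≁v u~v)

  link-intersects : ∀ {u v} → Intersects (edge u) (edge v) → Bool.T (is-just (link u v))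
  link-intersects {u} {v} meet with anchor u Finₚ.≟ anchor v | intersects? (edge u) (edge v)
  ... | yes _ | _          = _
  ... | no _  | yes _      = _
  ... | no _  | no ¬meet   = Empty-elim (¬meet meet)

  G : ColouredGraph r
  G = record
    { m      = m
    ; col    = symmetrise nothing link
    ; sym    = symmetrise-sym nothing link
    ; irrefl = symmetrise-diagonal nothing link
    }

  open ColouredGraph G using (col)

  col-shares : ∀ {u v c} → col u v ≡ just c → edge u c ≡ edge v c
  col-shares {u} {v} eq with u Finₚ.≟ v
  ... | yes refl = contradiction (trans (sym eq) (symmetrise-diagonal nothing link u)) λ ()
  ... | no u≢v with symmetrise-off-diagonal nothing link u≢v
  ...   | inj₁ e = link-shares (trans (sym e) eq)
  ...   | inj₂ e = sym (link-shares (trans (sym e) eq))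

  col-anchor : ∀ {u v} → u ≢ v → anchor u ≡ anchor v → col u v ≡ just (hit u)
  col-anchor u≢v u~v with symmetrise-off-diagonal nothing link u≢v
  ... | inj₁ e = trans e (link-anchor u~v)
  ... | inj₂ e = trans e (trans (link-anchor (sym u~v)) (cong just (same-part (sym u~v))))

  col-intersects : ∀ {u v} → u ≢ v → Intersects (edge u) (edge v) → Bool.T (is-just (col u v))
  col-intersects {u} {v} u≢v meet@(i , j , e) with symmetrise-off-diagonal nothing link u≢v
  ... | inj₁ eq = subst (Bool.T ∘ is-just) (sym eq) (link-intersects meet)
  ... | inj₂ eq = subst (Bool.T ∘ is-just) (sym eq) (link-intersects (j , i , sym e))

  intersectCount≤1+degree : ∀ u → intersectCount H (edge u) ℕ.≤ suc (degree G u)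
  intersectCount≤1+degree u =
    subst (λ es → length (filter (intersects? (edge u)) es) ℕ.≤ suc (degree G u)) (tabulate-lookup edges)
      (count-tabulate-mono-except (intersects? (edge u)) (λ w → T? (is-just (col u w))) edge id u
        (λ w w≢u → col-intersects (w≢u ∘ sym)))

  min-degree : ∀ {δ} → DeltaIntersecting δ H → MinDegreeAtLeast G ((1ℚ - δ) * ℕtoℚ m - 1ℚ)
  min-degree δ-intersecting u = ℚₚ.≤-trans
    (ℚₚ.+-monoˡ-≤ (- 1ℚ) (All.lookup δ-intersecting (∈-lookup u)))
    (ℕtoℚ-pred-≤ (intersectCount≤1+degree u))

  same-anchor? : ∀ w → Decidable (λ v → anchor v ≡ anchor w)
  same-anchor? w v = anchor v Finₚ.≟ anchor w

  class : Fin m → Subset m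
  class w = fromDecidable (same-anchor? w)

  star : Fin m → MonoTree G
  star w = Star.tree G (hit w) (class w) w (∈-fromDecidable⁺ (same-anchor? w) refl) spoke-colour
    where
    spoke-colour : ∀ u → u ∈ class w → u ≢ w → col u w ≡ just (hit w)
    spoke-colour u u∈ u≢w = trans (col-anchor u≢w u~w) (cong just (same-part u~w))
      where
      u~w : anchor u ≡ anchor w
      u~w = ∈-fromDecidable⁻ (same-anchor? w) u∈

  -- The fallback vertex only serves transversal vertices that anchor no edge.
  star-at : (x : Fin N) → Dec (∃[ w ] anchor w ≡ x) → Fin m → MonoTree G
  star-at x (yes (w , _)) _        = star w
  star-at x (no _)        fallback = star fallback

  ∈-star-at : ∀ {w x} → anchor w ≡ x → ∀ x-anchored fallback → w ∈ MonoTree.S (star-at x x-anchored fallback)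
  ∈-star-at w~x (yes (v , v~x)) _ = ∈-fromDecidable⁺ (same-anchor? v) (trans w~x (sym v~x))
  ∈-star-at w~x (no ¬anchored)  _ = Empty-elim (¬anchored (_ , w~x))

  Minimal : Set
  Minimal = ∀ T′ → IsTransversal H T′ → ∣ T ∣ ℕ.≤ ∣ T′ ∣

  some-edge : Minimal → Fin ∣ T ∣ → Fin m
  some-edge minimal j with m in m≡
  ... | suc _ = zero
  ... | zero  = Empty-elim (Finₚ.¬Fin0 (subst Fin ∣T∣≡0 j))
    where
    ⊥-transversal : IsTransversal H ⊥
    ⊥-transversal = transversal-by-index H (λ w → Empty-elim (Finₚ.¬Fin0 (subst Fin m≡ w)))
    ∣T∣≡0 : ∣ T ∣ ≡ 0
    ∣T∣≡0 = ℕₚ.n≤0⇒n≡0 (subst (∣ T ∣ ℕ.≤_) (∣⊥∣≡0 N) (minimal ⊥ ⊥-transversal))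

  cover : Minimal → CoveringTrees G ∣ T ∣
  cover minimal = trees , covered
    where
    anchored? : ∀ j → Dec (∃[ w ] anchor w ≡ enumerate T j)
    anchored? j = Finₚ.any? (λ w → anchor w Finₚ.≟ enumerate T j)
    trees : Fin ∣ T ∣ → MonoTree G
    trees j = star-at (enumerate T j) (anchored? j) (some-edge minimal j)
    covered : ∀ w → ∃[ j ] w ∈ MonoTree.S (trees j)
    covered w with j , j↦anchor ← enumerate-surjective T (anchor∈T w) =
      j , ∈-star-at (sym j↦anchor) (anchored? j) (some-edge minimal j)

  tree-shares : (tree : MonoTree G) → ∀ {u v} → Walk (MonoTree.F tree) u v →
                edge u (MonoTree.colour tree) ≡ edge v (MonoTree.colour tree)
  tree-shares tree stop                      = refl
  tree-shares tree (step {u} {w} adj rest) =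
    trans (col-shares (MonoTree.F-edge tree u w adj)) (tree-shares tree rest)

  transversal-of-cover : ∀ {k} → CoveringTrees G k → Σ[ T′ ∈ Subset N ] IsTransversal H T′ × ∣ T′ ∣ ℕ.≤ k
  transversal-of-cover {k} (trees , covered) = image shared , transversal-by-index H hits , ∣image∣≤ shared
    where
    shared : Fin k → Fin N
    shared i = edge (proj₁ (MonoTree.nonempty (trees i))) (MonoTree.colour (trees i))
    hits : ∀ w → ∃[ c ] edge w c ∈ image shared
    hits w with i , w∈ ← covered w =
      let open MonoTree (trees i)
          v , v∈ = nonempty
      in colour , subst (_∈ image shared) (sym (tree-shares (trees i) (connected w v w∈ v∈))) (∈-image shared i)

  cover-size-≥ : Minimal → ∀ k → CoveringTrees G k → ∣ T ∣ ℕ.≤ k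
  cover-size-≥ minimal k trees with T′ , T′-transversal , ∣T′∣≤k ← transversal-of-cover trees =
    ℕₚ.≤-trans (minimal T′ T′-transversal) ∣T′∣≤k

proposition3p5 : (r : ℕ) → 2 ≤ r → (δ : ℚ) → 0ℚ < δ → δ ≤ℚ 1ℚ →
    (H : RPartiteMultiGraph r) → DeltaIntersecting δ H →
    Σ[ G ∈ ColouredGraph r ]
      ( MinDegreeAtLeast G ((1ℚ - δ) * ℕtoℚ (ColouredGraph.m G) - 1ℚ)
      × Σ[ t ∈ ℕ ] (IsTau H t × IsTC G t) )
proposition3p5 (suc _) _ δ _ _ H δ-intersecting =
  G , min-degree {δ} δ-intersecting , ∣ T ∣ ,
  ((T , T-transversal , refl) , T-minimal) , (cover T-minimal , cover-size-≥ T-minimal)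
  where
  open RPartiteMultiGraph H using (N)
  minimum : Σ[ T ∈ Subset N ] IsTransversal H T × (∀ T′ → IsTransversal H T′ → ∣ T ∣ ℕ.≤ ∣ T′ ∣)
  minimum = minimum-size (transversal? H) (⊤-transversal H zero)
  T : Subset N
  T = proj₁ minimum
  T-transversal : IsTransversal H T
  T-transversal = proj₁ (proj₂ minimum)
  open TransversalGraph H T T-transversal
  T-minimal : Minimal
  T-minimal = proj₂ (proj₂ minimum)
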